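{- Let $k\geq 3$ be an integer. The family of sets $R_{i,j}$ with integers $i,j$ satisfying $k-3\leq i\leq k-2$ and $-F(i+1)\geq j\geq 1-F(k)$ (the $k$-th standard Fibonacci-like partition of the second kind) consists of $F(k)$ pairwise disjoint sets whose union is $\{n\in\mathbb N\mid n\geq F(k)\}$.
   Context: Let $\varphi=\frac{1+\sqrt5}{2}$ and $\mathbb N=\{1,2,3,\dots\}$. For $n\in\mathbb N$ put $a(n)=\lfloor n\varphi\rfloor$. $F$ denotes the Fibonacci sequence, $F(0)=0$, $F(1)=F(2)=1$, $F(n)=F(n-1)+F(n-2)$. For $i\in\mathbb Z^{\geq 0}$ and $j\in\mathbb Z$ define $f_{i,j}(n)=F(i+1)a(n)+F(i)n-j$ for $n\in\mathbb N$ and $R_{i,j}=\{f_{i,j}(n)\mid n\in\mathbb N\}$. -}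

module Defs where

open import Data.Nat using (ℕ; zero; suc; _+_; _*_; _∸_; _≤ᵇ_)
open import Data.Bool using (if_then_else_)
open import Data.Integer as ℤ using (ℤ; +_)
open import Data.Product using (Σ; ∃-syntax; _×_)
open import Relation.Binary.PropositionalEquality using (_≡_)

F : ℕ → ℕ
F zero = 0
F (suc zero) = 1
F (suc (suc n)) = F (suc n) + F n

-- Largest m ≤ bound with m*m ≤ m*n + n*n (or 0 if none).
-- Since φ² = φ + 1 and φ is irrational, for n ≥ 1 and m ≥ 0:
--   m ≤ nφ  ⇔  m² ≤ m n + n².
floorφ-aux : ℕ → ℕ → ℕ
floorφ-aux n zero = zero
floorφ-aux n (suc m) =
  if suc m * suc m ≤ᵇ suc m * n + n * n then suc m else floorφ-aux n m

-- a n = ⌊ n φ ⌋  (note n φ < 2 n)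
a : ℕ → ℕ
a n = floorφ-aux n (2 * n)

f : ℕ → ℤ → ℕ → ℤ
f i j n = (+ (F (suc i) * a n + F i * n)) ℤ.- j

InR : ℕ → ℤ → ℤ → Set
InR i j x = ∃[ n ] ((1 Data.Nat.≤ n) × (x ≡ f i j n))

Index : ℕ → Set
Index k = Σ (ℕ × ℤ) λ p →
  let i = Data.Product.proj₁ p ; j = Data.Product.proj₂ p in
  ((k ∸ 3 Data.Nat.≤ i) × (i Data.Nat.≤ k ∸ 2)) ×
  (((+ 1) ℤ.- (+ F k) ℤ.≤ j) × (j ℤ.≤ ℤ.- (+ F (suc i))))

{-# OPTIONS --safe #-}
-- Put β = F(m+1), γ = F(m+2), δ = F(m+3) = γ + β, G n = β a(n) + F(m) n and H n = γ a(n) + β n, so that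
-- R_{m,-t} = {G n + t} and R_{m+1,-t} = {H n + t}: the partition translates the block [β, δ) by every G n
-- and the block [γ, δ) by every H n (n ≥ 1), and it has γ + β = δ indices.
-- Since a(n+1) - a(n) ∈ {1, 2}, consecutive G-blocks either abut or leave a gap of length β, and a jumps
-- by 2 exactly at the points q = a(n+1) of its own range. As a(a(n+1)) = a(n+1) + n, H(n+1) = G(q) + β,
-- so the H-block of n + 1 fills precisely the gap after the G-block of q, and the blocks tile [δ, ∞).
-- The facts about a(n) = ⌊nφ⌋ all come from m ≤ nφ ⟺ m² ≤ mn + n², the irrationality of φ, and the
-- observation that (x, y) ↦ (x + y, x) is multiplication by φ.
module Submission where

open import Defs
open import Data.Bool using (true; false)
open import Data.Empty using (⊥; ⊥-elim)
open import Data.Fin using (Fin; toℕ; fromℕ<)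
open import Data.Fin.Properties using (toℕ-injective; toℕ<n; toℕ-fromℕ<; +↔⊎)
open import Data.Integer as ℤ using (ℤ; +_; -[1+_]; +≤+; +<+; 0ℤ)
import Data.Integer.Properties as ℤₚ
open import Data.Nat.Base using (ℕ; zero; suc; _+_; _*_; _≤_; _<_; _≥_; _≤ᵇ_; z≤n; s≤s; z<s; >-nonZero)
open import Data.Nat.Induction using (<-wellFounded)
open import Data.Nat.Properties
open import Data.Nat.Tactic.RingSolver using (solve-∀)
open import Data.Product using (Σ; ∃-syntax; _×_; _,_; proj₁; proj₂)
open import Data.Sum using (_⊎_; inj₁; inj₂)
open import Function.Base using (_∘_)
open import Function.Bundles using (_↔_; _⇔_; mk⇔; mk⤖)
open import Function.Definitions using (Injective; Surjective)
open import Function.Properties.Bijection using (⤖⇒↔)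
open import Function.Properties.Inverse using (↔-trans)
open import Induction.WellFounded using (Acc; acc)
open import Relation.Binary.Definitions using (tri<; tri≈; tri>)
open import Relation.Binary.PropositionalEquality
open import Relation.Unary using (Pred; Decidable)
open import Relation.Nullary using (¬_; contradiction; yes; no; ofʸ; ofⁿ)

-- Since φ² = φ + 1, for m, n : ℕ we have m ≤ φn iff m² ≤ mn + n², and likewise for <.
infix 4 _≤φ·_ _<φ·_

record _≤φ·_ (m n : ℕ) : Set where
  constructor mk≤φ·
  field ≤φ·-sq : m * m ≤ m * n + n * n

record _<φ·_ (m n : ℕ) : Set where
  constructor mk<φ·
  field <φ·-sq : m * m < m * n + n * n

open _≤φ·_
open _<φ·_

<φ·⇒≤φ· : ∀ {m n} → m <φ· n → m ≤φ· n
<φ·⇒≤φ· (mk<φ· lt) = mk≤φ· (<⇒≤ lt)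

cross-≤ : ∀ {a b c d} → a + d ≡ b + c → d ≤ c → b ≤ a
cross-≤ {a} {b} {c} {d} eq d≤c = +-cancelʳ-≤ d b a (≤-trans (+-monoʳ-≤ b d≤c) (≤-reflexive (sym eq)))

cross-< : ∀ {a b c d} → a + d ≡ b + c → d < c → b < a
cross-< {a} {b} {c} {d} eq d<c = +-cancelʳ-< d b a (≤-trans (+-monoʳ-< b d<c) (≤-reflexive (sym eq)))

cross-<⁻¹ : ∀ {a b c d} → a + d ≡ b + c → b < a → d < c
cross-<⁻¹ {a} {b} {c} {d} eq b<a = +-cancelˡ-< b d c (≤-trans (+-monoˡ-< d b<a) (≤-reflexive eq))

-- (x, y) ↦ (x + y, x) is multiplication by φ, and it negates the form m² - mn - n².
private
  φ·-identity : ∀ x y → (x + y) * (x + y) + x * x ≡ ((x + y) * x + x * x) + (x * y + y * y)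
  φ·-identity = solve-∀

<φ·⇒+≰φ· : ∀ {x y} → x <φ· y → ¬ (x + y ≤φ· x)
<φ·⇒+≰φ· {x} {y} (mk<φ· lt) (mk≤φ· le) = <⇒≱ (cross-< (φ·-identity x y) lt) le

+≰φ·⇒<φ· : ∀ {x y} → ¬ (x + y ≤φ· x) → x <φ· y
+≰φ·⇒<φ· {x} {y} ≰ = mk<φ· (cross-<⁻¹ (φ·-identity x y) (≰⇒> (λ le → ≰ (mk≤φ· le))))

≮φ·⇒+≤φ· : ∀ {x y} → ¬ (x <φ· y) → x + y ≤φ· x
≮φ·⇒+≤φ· {x} {y} ≮ = mk≤φ· (cross-≤ (sym (φ·-identity x y)) (≮⇒≥ (λ lt → ≮ (mk<φ· lt))))

+<φ·⇒≰φ· : ∀ {x y} → x + y <φ· x → ¬ (x ≤φ· y)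
+<φ·⇒≰φ· {x} {y} (mk<φ· lt) (mk≤φ· le) =
  <⇒≱ (cross-<⁻¹ (sym (φ·-identity x y)) lt) le

≤φ·-antimono : ∀ {m m′ n} → m ≤ m′ → m′ ≤φ· n → m ≤φ· n
≤φ·-antimono {m} {m′} {n} m≤m′ (mk≤φ· m′≤) with ≤-total m n | m≤n⇒∃[o]m+o≡n m≤m′
... | inj₁ m≤n | _ = mk≤φ· (≤-trans (*-monoʳ-≤ m m≤n) (m≤m+n (m * n) (n * n)))
... | inj₂ n≤m | t , refl = mk≤φ· (+-cancelʳ-≤ (t * n) (m * m) (m * n + n * n) (begin
  m * m + t * n        ≤⟨ +-monoʳ-≤ (m * m) (*-monoʳ-≤ t n≤m) ⟩
  m * m + t * m        ≡⟨ *-distribʳ-+ m m t ⟨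
  (m + t) * m          ≤⟨ *-monoʳ-≤ (m + t) (m≤m+n m t) ⟩
  (m + t) * (m + t)    ≤⟨ m′≤ ⟩
  (m + t) * n + n * n  ≡⟨ regroup m t n ⟩
  m * n + n * n + t * n ∎))
  where
  open ≤-Reasoning
  regroup : ∀ m t n → (m + t) * n + n * n ≡ m * n + n * n + t * n
  regroup = solve-∀

2n+1≰φ·n : ∀ n → ¬ (suc (2 * n) ≤φ· n)
2n+1≰φ·n n (mk≤φ· le) = <⇒≱ (m<m+n _ z<s) (≤-trans (≤-reflexive (expand n)) le)
  where
  expand : ∀ n → suc (2 * n) * n + n * n + suc (n * n + 3 * n) ≡ suc (2 * n) * suc (2 * n)
  expand = solve-∀

≤φ·⇒≤2* : ∀ {m n} → m ≤φ· n → m ≤ 2 * n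
≤φ·⇒≤2* {n = n} le = ≮⇒≥ (λ 2n<m → 2n+1≰φ·n n (≤φ·-antimono 2n<m le))

-- Besides m² ≤ mn + n², the shift only needs m ≤ 3n + 1, which follows from φ < 2.
private
  shift-identity : ∀ m n → (suc m * suc n + suc n * suc n) + (m * m + m)
                         ≡ suc m * suc m + ((m * n + n * n) + (2 * n + suc n))
  shift-identity = solve-∀

≤φ·-suc : ∀ {m n} → m ≤φ· n → suc m ≤φ· suc n
≤φ·-suc {m} {n} le = mk≤φ· (cross-≤ (shift-identity m n)
  (+-mono-≤ (≤φ·-sq le) (≤-trans (≤φ·⇒≤2* le) (m≤m+n (2 * n) (suc n)))))

<φ·-suc : ∀ {m n} → m <φ· n → suc m <φ· suc n
<φ·-suc {m} {n} lt = mk<φ· (cross-< (shift-identity m n)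
  (+-mono-<-≤ (<φ·-sq lt) (≤-trans (≤φ·⇒≤2* (<φ·⇒≤φ· lt)) (m≤m+n (2 * n) (suc n)))))

-- Descent: a solution (n + d, n) of m² = mn + n² with d > 0 yields the smaller solution (n, d).
private
  φ-descent : ∀ n d → (suc n + d) * (suc n + d) ≡ (suc n + d) * n + n * n → n * n ≡ n * suc d + suc d * suc d
  φ-descent n d eq = +-cancelˡ-≡ (n * n + n * suc d) _ _ (begin
    n * n + n * suc d + n * n               ≡⟨ expandˡ n d ⟩
    (suc n + d) * n + n * n                 ≡⟨ eq ⟨
    (suc n + d) * (suc n + d)               ≡⟨ expandʳ n d ⟩
    n * n + n * suc d + (n * suc d + suc d * suc d) ∎)
    where
    open ≡-Reasoning
    expandˡ : ∀ n d → n * n + n * suc d + n * n ≡ (suc n + d) * n + n * n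
    expandˡ = solve-∀
    expandʳ : ∀ n d → (suc n + d) * (suc n + d) ≡ n * n + n * suc d + (n * suc d + suc d * suc d)
    expandʳ = solve-∀

φ-irrational-acc : ∀ {m n} → Acc _<_ m → 0 < n → m * m ≢ m * n + n * n
φ-irrational-acc {m} {n} (acc rec) 0<n eq with m ≤? n
... | yes m≤n = <⇒≱ (m<m+n (m * n) (square-pos 0<n)) (≤-trans (≤-reflexive (sym eq)) (*-monoʳ-≤ m m≤n))
  where
  square-pos : ∀ {n} → 0 < n → 0 < n * n
  square-pos {suc n} _ = z<s
... | no m≰n with m≤n⇒∃[o]m+o≡n (≰⇒> m≰n)
...   | d , refl = φ-irrational-acc (rec (s≤s (m≤m+n n d))) z<s (φ-descent n d eq)

φ-irrational : ∀ {m n} → 0 < n → m * m ≢ m * n + n * n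
φ-irrational {m} = φ-irrational-acc (<-wellFounded m)

≤φ·⇒<φ· : ∀ {m n} → 0 < n → m ≤φ· n → m <φ· n
≤φ·⇒<φ· {m} 0<n (mk≤φ· le) = mk<φ· (≤∧≢⇒< le (φ-irrational {m} 0<n))

-- n + d + 1 > φn means n < φ(d + 1) (swap), which shifts to n + 1 < φ(d + 2); swap back.
≰φ·⇒3+≰φ·suc : ∀ {n d} → ¬ (suc (n + d) ≤φ· n) → ¬ (3 + (n + d) ≤φ· suc n)
≰φ·⇒3+≰φ·suc {n} {d} ≰ =
  subst (λ x → ¬ (x ≤φ· suc n)) (cong suc (trans (+-suc n (suc d)) (cong suc (+-suc n d))))
    (<φ·⇒+≰φ· (<φ·-suc (+≰φ·⇒<φ· (subst (λ x → ¬ (x ≤φ· n)) (sym (+-suc n d)) ≰))))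

floorφ-aux-spec : ∀ n M → ¬ (suc M ≤φ· n) → floorφ-aux n M ≤φ· n × ¬ (suc (floorφ-aux n M) ≤φ· n)
floorφ-aux-spec n zero ≰ = mk≤φ· z≤n , ≰
floorφ-aux-spec n (suc M) ≰
  with suc M * suc M ≤ᵇ suc M * n + n * n | ≤ᵇ-reflects-≤ (suc M * suc M) (suc M * n + n * n)
... | true  | ofʸ le = mk≤φ· le , ≰
... | false | ofⁿ ≰′ = floorφ-aux-spec n M (λ le → ≰′ (≤φ·-sq le))

a-≤φ· : ∀ n → a n ≤φ· n
a-≤φ· n = proj₁ (floorφ-aux-spec n (2 * n) (2n+1≰φ·n n))

suc-a-≰φ· : ∀ n → ¬ (suc (a n) ≤φ· n)
suc-a-≰φ· n = proj₂ (floorφ-aux-spec n (2 * n) (2n+1≰φ·n n))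

≤φ·⇒≤a : ∀ {m n} → m ≤φ· n → m ≤ a n
≤φ·⇒≤a {n = n} le = ≮⇒≥ (λ a<m → suc-a-≰φ· n (≤φ·-antimono a<m le))

≰φ·⇒a< : ∀ {m n} → ¬ (m ≤φ· n) → a n < m
≰φ·⇒a< {n = n} ≰ = ≰⇒> (λ m≤a → ≰ (≤φ·-antimono m≤a (a-≤φ· n)))

a-unique : ∀ {m n} → m ≤φ· n → ¬ (suc m ≤φ· n) → a n ≡ m
a-unique le ≰ = ≤-antisym (≤-pred (≰φ·⇒a< ≰)) (≤φ·⇒≤a le)

a-<φ· : ∀ {n} → 0 < n → a n <φ· n
a-<φ· {n} 0<n = ≤φ·⇒<φ· 0<n (a-≤φ· n)

n≤a : ∀ n → n ≤ a n
n≤a n = ≤φ·⇒≤a (mk≤φ· (m≤n+m (n * n) (n * n)))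

suc-a≤a-suc : ∀ n → suc (a n) ≤ a (suc n)
suc-a≤a-suc n = ≤φ·⇒≤a (≤φ·-suc (a-≤φ· n))

a-suc≤2+a : ∀ n → a (suc n) ≤ 2 + a n
a-suc≤2+a n with a n | n≤a n | suc-a-≰φ· n
... | _ | n≤an | ≰ with m≤n⇒∃[o]m+o≡n n≤an
...   | d , refl = ≤-pred (≰φ·⇒a< (≰φ·⇒3+≰φ·suc ≰))

a-suc-dichotomy : ∀ n → a (suc n) ≡ suc (a n) ⊎ a (suc n) ≡ 2 + a n
a-suc-dichotomy n with m≤n⇒m<n∨m≡n (a-suc≤2+a n)
... | inj₁ lt = inj₁ (≤-antisym (≤-pred lt) (suc-a≤a-suc n))
... | inj₂ eq = inj₂ eq

a-mono : ∀ {n n′} → n ≤ n′ → a n ≤ a n′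
a-mono {n′ = zero} z≤n = ≤-refl
a-mono {n} {suc n′} n≤1+n′ with m≤n⇒m<n∨m≡n n≤1+n′
... | inj₁ n<1+n′ = ≤-trans (a-mono (≤-pred n<1+n′)) (≤-trans (n≤1+n (a n′)) (suc-a≤a-suc n′))
... | inj₂ refl = ≤-refl

a∘a : ∀ n → a (a (suc n)) ≡ a (suc n) + n
a∘a n = a-unique le ≰
  where
  a′ = a (suc n)
  le : a′ + n ≤φ· a′
  le = ≮φ·⇒+≤φ· (λ lt → suc-a-≰φ· (suc n) (≤φ·-suc (<φ·⇒≤φ· lt)))
  ≰ : ¬ (suc (a′ + n) ≤φ· a′)
  ≰ = subst (λ x → ¬ (x ≤φ· a′)) (+-suc a′ n) (<φ·⇒+≰φ· (a-<φ· z<s))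

a-jump-at-image : ∀ n → a (suc (a (suc n))) ≡ 2 + a (a (suc n))
a-jump-at-image n = trans (a-unique le ≰) (cong (λ x → 2 + x) (sym (a∘a n)))
  where
  a′ = a (suc n)
  le : 2 + (a′ + n) ≤φ· suc a′
  le = subst (_≤φ· suc a′) (cong suc (+-suc a′ n))
         (≮φ·⇒+≤φ· (λ lt → suc-a-≰φ· (suc n) (<φ·⇒≤φ· lt)))
  ≰ : ¬ (3 + (a′ + n) ≤φ· suc a′)
  ≰ = subst (λ x → ¬ (x ≤φ· suc a′)) (cong suc (trans (+-suc a′ (suc n)) (cong suc (+-suc a′ n))))
        (<φ·⇒+≰φ· (<φ·-suc (a-<φ· z<s)))

a-jump⇒image : ∀ n → a (suc n) ≡ 2 + a n → ∃[ n′ ] a (suc n′) ≡ n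
a-jump⇒image n jump with a n | n≤a n | suc-a-≰φ· n
... | _ | n≤an | ≰ with m≤n⇒∃[o]m+o≡n n≤an
...   | d , refl = d , a-unique (<φ·⇒≤φ· lt) ≰′
  where
  lt : n <φ· suc d
  lt = +≰φ·⇒<φ· (subst (λ x → ¬ (x ≤φ· n)) (sym (+-suc n d)) ≰)
  ≰′ : ¬ (suc n ≤φ· suc d)
  ≰′ = +<φ·⇒≰φ· (subst (_<φ· suc n) (trans jump (cong suc (sym (+-suc n d)))) (a-<φ· z<s))

boundary : ∀ {p} {P : Pred ℕ p} → Decidable P → ∀ {m} b → P m → ¬ P (b + m) → ∃[ k ] m ≤ k × P k × ¬ P (suc k)
boundary P? zero Pm ¬Pm = contradiction Pm ¬Pm
boundary P? {m} (suc b) Pm ¬P[1+b+m] with P? (b + m)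
... | yes P[b+m] = b + m , m≤n+m m b , P[b+m] , ¬P[1+b+m]
... | no ¬P[b+m] = boundary P? b Pm ¬P[b+m]

infix 4 _∈[_,_⟩

_∈[_,_⟩ : ℕ → ℕ → ℕ → Set
x ∈[ l , u ⟩ = l ≤ x × x < u

+-∈[,⟩ : ∀ g {t l u} → t ∈[ l , u ⟩ → g + t ∈[ g + l , g + u ⟩
+-∈[,⟩ g (l≤t , t<u) = +-monoʳ-≤ g l≤t , +-monoʳ-< g t<u

∈[+,+⟩⇒offset : ∀ g {x l u} → x ∈[ g + l , g + u ⟩ → ∃[ t ] t ∈[ l , u ⟩ × x ≡ g + t
∈[+,+⟩⇒offset g {l = l} {u} (g+l≤x , x<g+u) with m≤n⇒∃[o]m+o≡n (≤-trans (m≤m+n g l) g+l≤x)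
... | t , refl = t , (+-cancelˡ-≤ g l t g+l≤x , +-cancelˡ-< g t u x<g+u) , refl

module _ (b : ℕ → ℕ) {l u : ℕ} (spaced : ∀ {n n′} → n < n′ → b n + u ≤ b n′ + l) where

  private
    translate-< : ∀ {n n′ t t′} → n < n′ → t ∈[ l , u ⟩ → t′ ∈[ l , u ⟩ → b n + t < b n′ + t′
    translate-< {n} {n′} n<n′ (_ , t<u) (l≤t′ , _) =
      ≤-trans (+-monoʳ-< (b n) t<u) (≤-trans (spaced n<n′) (+-monoʳ-≤ (b n′) l≤t′))

  spaced-translates-disjoint : ∀ {n n′ t t′} → t ∈[ l , u ⟩ → t′ ∈[ l , u ⟩ →
                               b n + t ≡ b n′ + t′ → n ≡ n′ × t ≡ t′
  spaced-translates-disjoint {n} {n′} {t} {t′} t∈ t′∈ eq with <-cmp n n′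
  ... | tri< n<n′ _ _ = contradiction eq (<⇒≢ (translate-< n<n′ t∈ t′∈))
  ... | tri≈ _ refl _ = refl , +-cancelˡ-≡ (b n) t t′ eq
  ... | tri> _ _ n′<n = contradiction (sym eq) (<⇒≢ (translate-< n′<n t′∈ t∈))

module Tiling (α β : ℕ) where

  γ δ : ℕ
  γ = β + α
  δ = γ + β

  G H : ℕ → ℕ
  G n = β * a n + α * n
  H n = γ * a n + β * n

  private
    step₁-identity : ∀ α β x n → β * suc x + α * suc n ≡ β * x + α * n + (β + α)
    step₁-identity = solve-∀
    step₂-identity : ∀ α β x n → β * (2 + x) + α * suc n ≡ β * x + α * n + (β + α + β)
    step₂-identity = solve-∀

  G-step₁ : ∀ n → a (suc n) ≡ suc (a n) → G (suc n) ≡ G n + γ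
  G-step₁ n eq = begin
    β * a (suc n) + α * suc n     ≡⟨ cong (λ x → β * x + α * suc n) eq ⟩
    β * suc (a n) + α * suc n     ≡⟨ step₁-identity α β (a n) n ⟩
    G n + γ                       ∎
    where open ≡-Reasoning

  G-step₂ : ∀ n → a (suc n) ≡ 2 + a n → G (suc n) ≡ G n + δ
  G-step₂ n eq = begin
    β * a (suc n) + α * suc n     ≡⟨ cong (λ x → β * x + α * suc n) eq ⟩
    β * (2 + a n) + α * suc n     ≡⟨ step₂-identity α β (a n) n ⟩
    G n + δ                       ∎
    where open ≡-Reasoning

  G-blocks-adjacent : ∀ n → a (suc n) ≡ suc (a n) → G (suc n) + β ≡ G n + δ
  G-blocks-adjacent n step₁ = begin
    G (suc n) + β   ≡⟨ cong (_+ β) (G-step₁ n step₁) ⟩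
    G n + γ + β     ≡⟨ +-assoc (G n) γ β ⟩
    G n + δ         ∎
    where open ≡-Reasoning

  G-mono : ∀ {n n′} → n ≤ n′ → G n ≤ G n′
  G-mono n≤n′ = +-mono-≤ (*-monoʳ-≤ β (a-mono n≤n′)) (*-monoʳ-≤ α n≤n′)

  G-suc-≥ : ∀ n → G n + γ ≤ G (suc n)
  G-suc-≥ n with a-suc-dichotomy n
  ... | inj₁ step₁ = ≤-reflexive (sym (G-step₁ n step₁))
  ... | inj₂ step₂ = ≤-trans (+-monoʳ-≤ (G n) (m≤m+n γ β)) (≤-reflexive (sym (G-step₂ n step₂)))

  G-spaced : ∀ {n n′} → n < n′ → G n + δ ≤ G n′ + β
  G-spaced {n} {n′} n<n′ = begin
    G n + (γ + β)  ≡⟨ +-assoc (G n) γ β ⟨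
    G n + γ + β    ≤⟨ +-monoˡ-≤ β (≤-trans (G-suc-≥ n) (G-mono n<n′)) ⟩
    G n′ + β       ∎
    where open ≤-Reasoning

  H-suc-≥ : ∀ n → H n + δ ≤ H (suc n)
  H-suc-≥ n = begin
    H n + δ                     ≡⟨ step₁-identity β γ (a n) n ⟨
    γ * suc (a n) + β * suc n   ≤⟨ +-monoˡ-≤ (β * suc n) (*-monoʳ-≤ γ (suc-a≤a-suc n)) ⟩
    H (suc n)                   ∎
    where open ≤-Reasoning

  H-mono : ∀ {n n′} → n ≤ n′ → H n ≤ H n′
  H-mono n≤n′ = +-mono-≤ (*-monoʳ-≤ γ (a-mono n≤n′)) (*-monoʳ-≤ β n≤n′)

  H-spaced : ∀ {n n′} → n < n′ → H n + δ ≤ H n′ + γ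
  H-spaced {n} {n′} n<n′ = ≤-trans (H-suc-≥ n) (≤-trans (H-mono n<n′) (m≤m+n (H n′) γ))

  H≡G∘a+β : ∀ n → H (suc n) ≡ G (a (suc n)) + β
  H≡G∘a+β n = begin
    γ * q + β * suc n          ≡⟨ regroup β α q n ⟩
    β * (q + n) + α * q + β    ≡⟨ cong (λ x → β * x + α * q + β) (a∘a n) ⟨
    G q + β                    ∎
    where
    open ≡-Reasoning
    q = a (suc n)
    regroup : ∀ β α x n → (β + α) * x + β * suc n ≡ β * (x + n) + α * x + β
    regroup = solve-∀

  H-block-lower : ∀ n → H (suc n) + γ ≡ G (a (suc n)) + δ
  H-block-lower n = trans (cong (_+ γ) (H≡G∘a+β n)) (assoc-comm (G (a (suc n))) β γ)
    where
    assoc-comm : ∀ g x y → g + x + y ≡ g + (y + x)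
    assoc-comm = solve-∀

  H-block-upper : ∀ n → H (suc n) + δ ≡ G (suc (a (suc n))) + β
  H-block-upper n = begin
    H (suc n) + δ          ≡⟨ cong (_+ δ) (H≡G∘a+β n) ⟩
    G q + β + δ            ≡⟨ right-comm (G q) β δ ⟩
    G q + δ + β            ≡⟨ cong (_+ β) (G-step₂ q (a-jump-at-image n)) ⟨
    G (suc q) + β          ∎
    where
    open ≡-Reasoning
    q = a (suc n)
    right-comm : ∀ g x y → g + x + y ≡ g + y + x
    right-comm = solve-∀

  H-block-in-G-gap : ∀ n {t} → t ∈[ γ , δ ⟩ → H (suc n) + t ∈[ G (a (suc n)) + δ , G (suc (a (suc n))) + β ⟩
  H-block-in-G-gap n {t} t∈ = subst₂ (H (suc n) + t ∈[_,_⟩) (H-block-lower n) (H-block-upper n) (+-∈[,⟩ (H (suc n)) t∈)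

  G-blocks-disjoint : ∀ {n n′ t t′} → t ∈[ β , δ ⟩ → t′ ∈[ β , δ ⟩ → G n + t ≡ G n′ + t′ → n ≡ n′ × t ≡ t′
  G-blocks-disjoint = spaced-translates-disjoint G G-spaced

  H-blocks-disjoint : ∀ {n n′ t t′} → t ∈[ γ , δ ⟩ → t′ ∈[ γ , δ ⟩ → H n + t ≡ H n′ + t′ → n ≡ n′ × t ≡ t′
  H-blocks-disjoint = spaced-translates-disjoint H H-spaced

  G-block-outside-gap : ∀ q {n t x} → t ∈[ β , δ ⟩ → x ∈[ G q + δ , G (suc q) + β ⟩ → G n + t ≢ x
  G-block-outside-gap q {n} {t} (β≤t , t<δ) (gap≤x , x<gap) eq with n ≤? q
  ... | yes n≤q = <⇒≢ (≤-trans (+-monoʳ-< (G n) t<δ) (≤-trans (+-monoˡ-≤ δ (G-mono n≤q)) gap≤x)) eq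
  ... | no n≰q = <⇒≢ (≤-trans x<gap (≤-trans (+-monoˡ-≤ β (G-mono (≰⇒> n≰q))) (+-monoʳ-≤ (G n) β≤t))) (sym eq)

  G-H-blocks-disjoint : ∀ {n n′ t t′} → t ∈[ β , δ ⟩ → t′ ∈[ γ , δ ⟩ → G n + t ≢ H (suc n′) + t′
  G-H-blocks-disjoint {n′ = n′} t∈ t′∈ = G-block-outside-gap (a (suc n′)) t∈ (H-block-in-G-gap n′ t′∈)

  G-1 : G 1 ≡ γ
  G-1 = cong₂ _+_ (*-identityʳ β) (*-identityʳ α)

  G-block-≥δ : ∀ {n t} → 1 ≤ n → β ≤ t → δ ≤ G n + t
  G-block-≥δ {n} {t} 1≤n β≤t = subst (_≤ G n + t) (cong (_+ β) G-1) (+-mono-≤ (G-mono 1≤n) β≤t)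

  H-block-≥δ : ∀ {n t} → 1 ≤ n → γ ≤ t → δ ≤ H n + t
  H-block-≥δ {n} {t} 1≤n γ≤t = subst (δ ≤_) (+-comm t (H n)) (+-mono-≤ γ≤t β≤H)
    where
    β≤H : β ≤ H n
    β≤H = ≤-trans (m≤m*n β n {{>-nonZero 1≤n}}) (m≤n+m (β * n) (γ * a n))

  n≤G : 0 < γ → ∀ n → n ≤ G n
  n≤G γ>0 n = begin
    n              ≤⟨ m≤n*m n γ {{>-nonZero γ>0}} ⟩
    γ * n          ≡⟨ *-distribʳ-+ n β α ⟩
    β * n + α * n  ≤⟨ +-monoˡ-≤ (α * n) (*-monoʳ-≤ β (n≤a n)) ⟩
    G n            ∎
    where open ≤-Reasoning

  gap⊆H-block : ∀ n {x} → x ∈[ G n + δ , G (suc n) + β ⟩ → ∃[ n′ ] 1 ≤ n′ × ∃[ t ] t ∈[ γ , δ ⟩ × x ≡ H n′ + t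
  gap⊆H-block n {x} (G+δ≤x , x<G′+β) with a-suc-dichotomy n
  ... | inj₁ step₁ = contradiction (≤-trans (≤-reflexive (G-blocks-adjacent n step₁)) G+δ≤x) (<⇒≱ x<G′+β)
  ... | inj₂ step₂ with a-jump⇒image n step₂
  ...   | n′ , a[1+n′]≡n = suc n′ , s≤s z≤n , ∈[+,+⟩⇒offset (H (suc n′)) (lower , upper)
    where
    lower : H (suc n′) + γ ≤ x
    lower = ≤-trans (≤-reflexive (trans (H-block-lower n′) (cong (λ q → G q + δ) a[1+n′]≡n))) G+δ≤x
    upper : x < H (suc n′) + δ
    upper = ≤-trans x<G′+β (≤-reflexive (sym (trans (H-block-upper n′) (cong (λ q → G (suc q) + β) a[1+n′]≡n))))

  -- x lies in the last G-block starting at or below it, or in the gap after that block.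
  blocks-cover : 0 < γ → ∀ {x} → δ ≤ x →
    (∃[ n ] 1 ≤ n × ∃[ t ] t ∈[ β , δ ⟩ × x ≡ G n + t) ⊎ (∃[ n ] 1 ≤ n × ∃[ t ] t ∈[ γ , δ ⟩ × x ≡ H n + t)
  blocks-cover γ>0 {x} δ≤x with boundary (λ n → G n + β ≤? x) x first last
    where
    first : G 1 + β ≤ x
    first = subst (_≤ x) (cong (_+ β) (sym G-1)) δ≤x
    last : ¬ (G (x + 1) + β ≤ x)
    last = <⇒≱ (≤-trans (subst (x <_) (+-comm 1 x) ≤-refl) (≤-trans (n≤G γ>0 (x + 1)) (m≤m+n _ β)))
  ... | n , 1≤n , G+β≤x , x≮G′+β with x <? G n + δ
  ...   | yes x<G+δ = inj₁ (n , 1≤n , ∈[+,+⟩⇒offset (G n) (G+β≤x , x<G+δ))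
  ...   | no x≮G+δ = inj₂ (gap⊆H-block n (≮⇒≥ x≮G+δ , ≰⇒> x≮G′+β))

F-suc-pos : ∀ n → 0 < F (suc n)
F-suc-pos zero = z<s
F-suc-pos (suc n) = ≤-trans (F-suc-pos n) (m≤m+n (F (suc n)) (F n))

f-neg : ∀ i t n → f i (ℤ.- + t) n ≡ + (F (suc i) * a n + F i * n + t)
f-neg i t n = cong (λ z → + (F (suc i) * a n + F i * n) ℤ.+ z) (ℤₚ.neg-involutive (+ t))

≤0⇒neg : ∀ {j} → j ℤ.≤ 0ℤ → ∃[ t ] j ≡ ℤ.- + t
≤0⇒neg {+ zero} _ = 0 , refl
≤0⇒neg {+ suc _} (+≤+ ())
≤0⇒neg { -[1+ t ]} _ = suc t , refl

-- 1 - d ≤ -t is sucℤ (- d) ≤ - t, i.e. - d < - t.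
neg-range⇒range : ∀ {c d t} → + 1 ℤ.- + d ℤ.≤ ℤ.- + t → ℤ.- + t ℤ.≤ ℤ.- + c → t ∈[ c , d ⟩
neg-range⇒range lo hi = ℤₚ.drop‿+≤+ (ℤₚ.neg-cancel-≤ hi) , ℤₚ.drop‿+<+ (ℤₚ.neg-cancel-< (ℤₚ.suc[i]≤j⇒i<j lo))

range⇒neg-range : ∀ {c d t} → t ∈[ c , d ⟩ → + 1 ℤ.- + d ℤ.≤ ℤ.- + t × ℤ.- + t ℤ.≤ ℤ.- + c
range⇒neg-range (c≤t , t<d) = ℤₚ.i<j⇒suc[i]≤j (ℤₚ.neg-mono-< (+<+ t<d)) , ℤₚ.neg-mono-≤ (+≤+ c≤t)

neg-offset-injective : ∀ c {x y} → ℤ.- + (c + x) ≡ ℤ.- + (c + y) → x ≡ y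
neg-offset-injective c eq = +-cancelˡ-≡ c _ _ (ℤₚ.+-injective (ℤₚ.neg-injective eq))

module Partition (m : ℕ) where

  open Tiling (F m) (F (suc m))

  k β : ℕ
  k = 3 + m
  β = F (suc m)

  Index-≡ : {p q : Index k} → proj₁ p ≡ proj₁ q → p ≡ q
  Index-≡ {_ , (l , u) , (l′ , u′)} {_ , (r , v) , (r′ , v′)} refl
    rewrite ≤-irrelevant l r | ≤-irrelevant u v | ℤₚ.≤-irrelevant l′ r′ | ℤₚ.≤-irrelevant u′ v′ = refl

  data IndexView : ℕ → ℤ → Set where
    lower : ∀ {t} → t ∈[ β , δ ⟩ → IndexView m (ℤ.- + t)
    upper : ∀ {t} → t ∈[ γ , δ ⟩ → IndexView (suc m) (ℤ.- + t)

  view : (p : Index k) → IndexView (proj₁ (proj₁ p)) (proj₂ (proj₁ p))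
  view ((i , j) , (m≤i , i≤1+m) , (lo , hi)) with ≤0⇒neg (ℤₚ.≤-trans hi ℤₚ.neg-≤-pos)
  ... | t , refl with m≤n⇒m<n∨m≡n i≤1+m
  ...   | inj₂ refl = upper (neg-range⇒range lo hi)
  ...   | inj₁ i<1+m with ≤-antisym m≤i (≤-pred i<1+m)
  ...     | refl = lower (neg-range⇒range lo hi)

  toIndex : ∀ {i j} → IndexView i j → Index k
  toIndex (lower t∈) = (m , _) , (≤-refl , n≤1+n m) , range⇒neg-range t∈
  toIndex (upper t∈) = (suc m , _) , (n≤1+n m , ≤-refl) , range⇒neg-range t∈

  point : ∀ {i j} → IndexView i j → ℕ → ℕ
  point (lower {t} _) n = G n + t
  point (upper {t} _) n = H n + t

  f≡point : ∀ {i j} (v : IndexView i j) n → f i j n ≡ + point v n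
  f≡point (lower {t} _) n = f-neg m t n
  f≡point (upper {t} _) n = f-neg (suc m) t n

  point-injective : ∀ {i j i′ j′ n n′} (v : IndexView i j) (v′ : IndexView i′ j′) →
                    1 ≤ n → 1 ≤ n′ → point v n ≡ point v′ n′ → (i , j) ≡ (i′ , j′)
  point-injective (lower t∈) (lower t′∈) _ _ eq = cong (λ t → m , ℤ.- + t) (proj₂ (G-blocks-disjoint t∈ t′∈ eq))
  point-injective (upper t∈) (upper t′∈) _ _ eq = cong (λ t → suc m , ℤ.- + t) (proj₂ (H-blocks-disjoint t∈ t′∈ eq))
  point-injective (lower t∈) (upper t′∈) _ (s≤s _) eq = ⊥-elim (G-H-blocks-disjoint t∈ t′∈ eq)
  point-injective (upper t∈) (lower t′∈) (s≤s _) _ eq = ⊥-elim (G-H-blocks-disjoint t′∈ t∈ (sym eq))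

  point-≥δ : ∀ {i j n} (v : IndexView i j) → 1 ≤ n → δ ≤ point v n
  point-≥δ (lower (β≤t , _)) 1≤n = G-block-≥δ 1≤n β≤t
  point-≥δ (upper (γ≤t , _)) 1≤n = H-block-≥δ 1≤n γ≤t

  index : Fin γ ⊎ Fin β → Index k
  index (inj₁ u) = toIndex (lower (m≤m+n β (toℕ u) , subst (β + toℕ u <_) (+-comm β γ) (+-monoʳ-< β (toℕ<n u))))
  index (inj₂ u) = toIndex (upper (m≤m+n γ (toℕ u) , +-monoʳ-< γ (toℕ<n u)))

  index-injective : Injective _≡_ _≡_ index
  index-injective {inj₁ _} {inj₁ _} eq = cong inj₁ (toℕ-injective (neg-offset-injective β (cong (proj₂ ∘ proj₁) eq)))
  index-injective {inj₂ _} {inj₂ _} eq = cong inj₂ (toℕ-injective (neg-offset-injective γ (cong (proj₂ ∘ proj₁) eq)))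
  index-injective {inj₁ _} {inj₂ _} eq = ⊥-elim (1+n≢n (sym (cong (proj₁ ∘ proj₁) eq)))
  index-injective {inj₂ _} {inj₁ _} eq = ⊥-elim (1+n≢n (cong (proj₁ ∘ proj₁) eq))

  index-surjective : Surjective _≡_ _≡_ index
  index-surjective ((i , j) , c) with view ((i , j) , c)
  ... | lower (β≤t , t<δ) with m≤n⇒∃[o]m+o≡n β≤t
  ...   | o , refl = inj₁ (fromℕ< o<γ) , λ { refl → Index-≡ (cong (λ x → m , ℤ.- + (β + x)) (toℕ-fromℕ< o<γ)) }
    where
    o<γ : o < γ
    o<γ = +-cancelˡ-< β o γ (subst (β + o <_) (+-comm γ β) t<δ)
  index-surjective ((i , j) , c) | upper (γ≤t , t<δ) with m≤n⇒∃[o]m+o≡n γ≤t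
  ...   | o , refl = inj₂ (fromℕ< o<β) , λ { refl → Index-≡ (cong (λ x → suc m , ℤ.- + (γ + x)) (toℕ-fromℕ< o<β)) }
    where
    o<β : o < β
    o<β = +-cancelˡ-< γ o β t<δ

  Fin↔Index : Fin (F k) ↔ Index k
  Fin↔Index = ↔-trans +↔⊎ (⤖⇒↔ (mk⤖ {to = index} (index-injective , index-surjective)))

  disjoint : (p q : Index k) → proj₁ p ≢ proj₁ q → (x : ℤ) →
    InR (proj₁ (proj₁ p)) (proj₂ (proj₁ p)) x → InR (proj₁ (proj₁ q)) (proj₂ (proj₁ q)) x → ⊥
  disjoint p q p≢q x (n , 1≤n , refl) (n′ , 1≤n′ , eq) = p≢q (point-injective (view p) (view q) 1≤n 1≤n′
    (ℤₚ.+-injective (trans (sym (f≡point (view p) n)) (trans eq (f≡point (view q) n′)))))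

  covered⇒≥δ : (x : ℤ) → Σ (Index k) (λ p → InR (proj₁ (proj₁ p)) (proj₂ (proj₁ p)) x) → + F k ℤ.≤ x
  covered⇒≥δ x (p , n , 1≤n , refl) = subst (+ δ ℤ.≤_) (sym (f≡point (view p) n)) (+≤+ (point-≥δ (view p) 1≤n))

  ≥δ⇒covered : (x : ℤ) → + F k ℤ.≤ x → Σ (Index k) λ p → InR (proj₁ (proj₁ p)) (proj₂ (proj₁ p)) x
  ≥δ⇒covered (+ y) (+≤+ δ≤y) with blocks-cover (F-suc-pos (suc m)) δ≤y
  ... | inj₁ (n , 1≤n , t , t∈ , refl) = toIndex (lower t∈) , n , 1≤n , sym (f-neg m t n)
  ... | inj₂ (n , 1≤n , t , t∈ , refl) = toIndex (upper t∈) , n , 1≤n , sym (f-neg (suc m) t n)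

corollary3p9 : (k : ℕ) → k ≥ 3 →
    (Fin (F k) ↔ Index k) ×
    ((p q : Index k) → proj₁ p ≢ proj₁ q → (x : ℤ) →
      InR (proj₁ (proj₁ p)) (Data.Product.proj₂ (proj₁ p)) x →
      InR (proj₁ (proj₁ q)) (Data.Product.proj₂ (proj₁ q)) x → ⊥) ×
    ((x : ℤ) → ((+ F k) ℤ.≤ x) ⇔ (Σ (Index k) λ p → InR (proj₁ (proj₁ p)) (Data.Product.proj₂ (proj₁ p)) x))
corollary3p9 (suc (suc (suc m))) (s≤s (s≤s (s≤s z≤n))) =
  Fin↔Index , disjoint , λ x → mk⇔ (≥δ⇒covered x) (covered⇒≥δ x)
  where open Partition m
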